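{- Let $f \colon \mathbb{Z} \to \mathbb{N}_0 \cup \{\infty\}$ be a function such that $f^{ -1}(0)$ is finite, and let $(u_k)_{k\ge 1}$ be a sequence of integers such that $f(n) = \mathrm{card}\{k\ge 1 : u_k = n\}$ for every $n\in\mathbb{Z}$. Let $A$ be a finite set of integers with $0\notin A$ and $r_A(n)\le f(n)$ for all integers $n$, and suppose there is an integer $m$ such that $r_A(n) \ge \#\{i\le m : u_i = n\}$ for all integers $n$. Then there exists a finite set of integers $B$ with $A\subseteq B$, $0\notin B$, $r_B(n)\le f(n)$ for all integers $n$, and $r_B(n) \ge \#\{i \le m+1 : u_i = n\}$ for all integers $n$ (where indices $i$ range over positive integers).
   Context: $\mathbb{N}_0$ denotes the set of nonnegative integers. For a set $A$ of integers, the representation function is $r_A(n) = \mathrm{card}\{(a,b) : a,b\in A,\ a\le b,\ a+b=n\}$ for $n\in\mathbb{Z}$. -}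

module Defs where

open import Data.Nat using (ℕ; zero; suc; _+_; _≤_)
open import Data.Integer as ℤ using (ℤ)
open import Data.List using (List; length; filter; cartesianProduct)
open import Data.Product using (_×_; _,_; ∃; proj₁; proj₂)
open import Relation.Nullary.Decidable using (_×-dec_; does)
open import Relation.Binary.PropositionalEquality using (_≡_)
open import Data.Bool using (if_then_else_)
open import Data.Unit using (⊤)

data ℕ∞ : Set where
  fin : ℕ → ℕ∞
  ∞   : ℕ∞

_≤∞_ : ℕ → ℕ∞ → Set
n ≤∞ fin c = n ≤ c
n ≤∞ ∞     = ⊤

-- A sequence (u_k)_{k ≥ 1} of integers is modelled as u : ℕ → ℤ,
-- where only the values u 1, u 2, ... are used (u 0 is ignored).
-- count u m n = #{ i : 1 ≤ i ≤ m , u_i = n }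
count : (ℕ → ℤ) → ℕ → ℤ → ℕ
count u zero    n = 0
count u (suc m) n = count u m n + (if does (u (suc m) ℤ.≟ n) then 1 else 0)

-- card { k ≥ 1 : u_k = n } = x, for x ∈ ℕ₀ ∪ {∞}.
-- finite c : the set has exactly c elements (all initial counts ≤ c, some equals c)
-- ∞        : the set is infinite (initial counts are unbounded)
CardIndices : (ℕ → ℤ) → ℤ → ℕ∞ → Set
CardIndices u n (fin c) = (∀ m → count u m n ≤ c) × ∃ λ m → count u m n ≡ c
CardIndices u n ∞       = ∀ c → ∃ λ m → c ≤ count u m n

-- A finite set of integers is a duplicate-free list (see Statement).
-- r_A(n) = card{ (a,b) : a,b ∈ A , a ≤ b , a + b = n }
r : List ℤ → ℤ → ℕ
r A n = length (filter (λ p → (proj₁ p ℤ.≤? proj₂ p) ×-dec (proj₁ p ℤ.+ proj₂ p ℤ.≟ n))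
                       (cartesianProduct A A))

{-# OPTIONS --safe #-}

-- If t = u (m + 1) is already represented often enough, take B = A. Otherwise let κ exceed
-- |z| for t, for every element of A and for every zero of f (all listed in L), and add
-- x = 5κ and y = t - x to A. The pair (y , x) is one new representation of t; every other
-- new sum (y + y, y + a, x + a, x + x with a ∈ A) lies in one of the disjoint ranges
-- [-12κ, -8κ], [-7κ, -3κ], [4κ, 6κ], {10κ}, and since A is a set each range holds at most
-- one of them. On [-2κ, 2κ], which contains A + A, t and the zeros of f, r_B thus only gains
-- the new representation of t, which fits because r_A(t) < #{i ≤ m+1 : u_i = t} ≤ f(t);
-- outside it r_A = 0, r_B ≤ 1 and f ≥ 1.

module Submission where

open import Defs
open import Data.Nat using (ℕ; _≤_; suc)
open import Data.Integer using (ℤ; 0ℤ)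
open import Data.List using (List)
open import Data.List.Membership.Propositional using (_∈_; _∉_)
open import Data.List.Relation.Binary.Subset.Propositional using (_⊆_)
open import Data.List.Relation.Unary.Unique.Propositional using (Unique)
open import Data.Product using (_×_; Σ; ∃)
open import Relation.Binary.PropositionalEquality using (_≡_)

open import Level using (Level; 0ℓ)
open import Function using (_∘_; id)
open import Data.Bool using (true; false; if_then_else_)
open import Data.Empty using (⊥; ⊥-elim)
open import Data.Unit using (tt)
open import Data.Sum using (_⊎_; inj₁; inj₂; [_,_]′)
open import Data.Product using (_,_; proj₁; proj₂)
open import Data.Nat using (zero; _+_; z≤n; s≤s; _≤?_)
import Data.Nat.Properties as ℕₚ
open import Data.Nat.ListAction using (sum)
open import Data.Nat.Tactic.RingSolver using (solve-∀)
open import Algebra.Properties.CommutativeSemigroup ℕₚ.+-commutativeSemigroup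
  using (x∙yz≈y∙xz; interchange)
import Data.Integer as ℤ
open import Data.Integer using (+[1+_]; ∣_∣; -≤+; +≤+; -≤-)
open import Data.Integer.Literals using (negative)
import Data.Integer.Properties as ℤₚ
open import Algebra.Bundles using (AbelianGroup)
open import Algebra.Properties.Group (AbelianGroup.group ℤₚ.+-0-abelianGroup)
  using (∙-cancelˡ; //-rightDividesˡ)
open import Data.List using ([]; _∷_; _++_; map; filter; length; cartesianProduct)
open import Data.List.Properties using (filter-++; filter-none; length-++)
open import Data.List.Relation.Unary.All as All using (All; []; _∷_)
open import Data.List.Relation.Unary.Any using (Any; here; there)
open import Data.List.Relation.Unary.AllPairs using ([]; _∷_)
open import Data.List.Membership.Propositional.Properties
  using (∈-++⁺ˡ; ∈-++⁺ʳ; ∈-cartesianProduct⁻)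
open import Relation.Nullary using (Dec; yes; no; does; ¬_)
open import Relation.Nullary.Decidable
  using (_×-dec_; _⊎-dec_; True; toWitness; fromWitness; from-yes; map′)
open import Relation.Unary using (Pred; Decidable; ∁)
open import Relation.Binary.PropositionalEquality
  using (_≢_; refl; sym; trans; cong; cong₂; subst; module ≡-Reasoning)

private
  instance
    ℤ-negative = negative
    literal-constraint = tt

  variable
    a b ℓ : Level

indicator : {Q : Set ℓ} → Dec Q → ℕ
indicator Q? = if does Q? then 1 else 0

indicator≤1 : {Q : Set ℓ} (Q? : Dec Q) → indicator Q? ≤ 1
indicator≤1 (yes _) = s≤s z≤n
indicator≤1 (no _)  = z≤n

indicator-yes : {Q : Set ℓ} (Q? : Dec Q) → Q → indicator Q? ≡ 1
indicator-yes (yes _) _ = refl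
indicator-yes (no ¬q) q = ⊥-elim (¬q q)

indicator-no : {Q : Set ℓ} (Q? : Dec Q) → ¬ Q → indicator Q? ≡ 0
indicator-no (yes q) ¬q = ⊥-elim (¬q q)
indicator-no (no _)  _  = refl

indicator-witness : {Q : Set ℓ} (Q? : Dec Q) → 1 ≤ indicator Q? → Q
indicator-witness (yes q) _ = q

#[_] : {X : Set a} {P : Pred X ℓ} → Decidable P → List X → ℕ
#[ P? ] xs = length (filter P? xs)

module _ {X : Set a} {P : Pred X ℓ} (P? : Decidable P) where

  #-∷ : (x : X) (xs : List X) → #[ P? ] (x ∷ xs) ≡ indicator (P? x) + #[ P? ] xs
  #-∷ x xs with does (P? x)
  ... | true  = refl
  ... | false = refl

  #-++ : (xs ys : List X) → #[ P? ] (xs ++ ys) ≡ #[ P? ] xs + #[ P? ] ys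
  #-++ xs ys = trans (cong length (filter-++ P? xs ys)) (length-++ (filter P? xs))

  #-map : {Y : Set b} (g : Y → X) (ys : List Y) → #[ P? ] (map g ys) ≡ #[ P? ∘ g ] ys
  #-map g []       = refl
  #-map g (y ∷ ys) with does (P? (g y))
  ... | true  = cong suc (#-map g ys)
  ... | false = #-map g ys

  #-none : {xs : List X} → All (∁ P) xs → #[ P? ] xs ≡ 0
  #-none ¬P = cong length (filter-none P? ¬P)

  #-any : (xs : List X) → 1 ≤ #[ P? ] xs → Any P xs
  #-any (x ∷ xs) pos with P? x
  ... | yes px = here px
  ... | no  _  = there (#-any xs pos)

  #-unique≤1 : (∀ {x y} → P x → P y → x ≡ y) → {xs : List X} → Unique xs → #[ P? ] xs ≤ 1
  #-unique≤1 P-unique [] = z≤n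
  #-unique≤1 P-unique {x ∷ xs} (x≢xs ∷ xs-unique) with P? x
  ... | yes px = s≤s (ℕₚ.≤-reflexive (#-none (All.map (λ x≢y py → x≢y (P-unique px py)) x≢xs)))
  ... | no  _  = #-unique≤1 P-unique xs-unique

#-cartesianProduct-∷ʳ : {X : Set a} {P : Pred (X × X) ℓ} (P? : Decidable P)
  (xs : List X) (y : X) (ys : List X) →
  #[ P? ] (cartesianProduct xs (y ∷ ys)) ≡ #[ P? ∘ (_, y) ] xs + #[ P? ] (cartesianProduct xs ys)
#-cartesianProduct-∷ʳ P? []       y ys = refl
#-cartesianProduct-∷ʳ P? (x ∷ xs) y ys = begin
  #[ P? ] ((x , y) ∷ map (x ,_) ys ++ cartesianProduct xs (y ∷ ys))
    ≡⟨ #-∷ P? (x , y) _ ⟩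
  i + #[ P? ] (map (x ,_) ys ++ cartesianProduct xs (y ∷ ys))
    ≡⟨ cong (i +_) (#-++ P? (map (x ,_) ys) _) ⟩
  i + (row + #[ P? ] (cartesianProduct xs (y ∷ ys)))
    ≡⟨ cong (λ c → i + (row + c)) (#-cartesianProduct-∷ʳ P? xs y ys) ⟩
  i + (row + (column + rest))
    ≡⟨ cong (i +_) (x∙yz≈y∙xz row column rest) ⟩
  i + (column + (row + rest))
    ≡⟨ ℕₚ.+-assoc i column (row + rest) ⟨
  (i + column) + (row + rest)
    ≡⟨ cong₂ _+_ (#-∷ (P? ∘ (_, y)) x xs) (#-++ P? (map (x ,_) ys) (cartesianProduct xs ys)) ⟨
  #[ P? ∘ (_, y) ] (x ∷ xs) + #[ P? ] (cartesianProduct (x ∷ xs) ys) ∎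
  where
  open ≡-Reasoning
  i row column rest : ℕ
  i = indicator (P? (x , y))
  row = #[ P? ] (map (x ,_) ys)
  column = #[ P? ∘ (_, y) ] xs
  rest = #[ P? ] (cartesianProduct xs ys)

Representation : ℤ → Pred (ℤ × ℤ) 0ℓ
Representation n p = proj₁ p ℤ.≤ proj₂ p × proj₁ p ℤ.+ proj₂ p ≡ n

representation? : ∀ n → Decidable (Representation n)
representation? n p = (proj₁ p ℤ.≤? proj₂ p) ×-dec (proj₁ p ℤ.+ proj₂ p ℤ.≟ n)

indicator-representation-diag : ∀ n z →
  indicator (representation? n (z , z)) ≡ indicator (z ℤ.+ z ℤ.≟ n)
indicator-representation-diag n z with z ℤ.≤? z
... | yes _   = refl
... | no  z≰z = ⊥-elim (z≰z ℤₚ.≤-refl)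

-- Exactly one of (z , b) and (b , z) is ordered.
indicator-representation-swap : ∀ n {z b} → z ≢ b →
  indicator (representation? n (z , b)) + indicator (representation? n (b , z))
    ≡ indicator (z ℤ.+ b ℤ.≟ n)
indicator-representation-swap n {z} {b} z≢b with z ℤ.≤? b | b ℤ.≤? z
... | yes z≤b | yes b≤z = ⊥-elim (z≢b (ℤₚ.≤-antisym z≤b b≤z))
... | yes _   | no  _   = ℕₚ.+-identityʳ _
... | no  _   | yes _   rewrite ℤₚ.+-comm b z = refl
... | no  z≰b | no  b≰z = ⊥-elim ([ z≰b , b≰z ]′ (ℤₚ.≤-total z b))

#-representation-swap : ∀ n {z} (bs : List ℤ) → All (z ≢_) bs →
  #[ representation? n ∘ (z ,_) ] bs + #[ representation? n ∘ (_, z) ] bs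
    ≡ #[ (λ b → z ℤ.+ b ℤ.≟ n) ] bs
#-representation-swap n     []       []           = refl
#-representation-swap n {z} (b ∷ bs) (z≢b ∷ z≢bs) = begin
  #[ R ∘ (z ,_) ] (b ∷ bs) + #[ R ∘ (_, z) ] (b ∷ bs)
    ≡⟨ cong₂ _+_ (#-∷ (R ∘ (z ,_)) b bs) (#-∷ (R ∘ (_, z)) b bs) ⟩
  (indicator (R (z , b)) + #[ R ∘ (z ,_) ] bs) + (indicator (R (b , z)) + #[ R ∘ (_, z) ] bs)
    ≡⟨ interchange (indicator (R (z , b))) _ (indicator (R (b , z))) _ ⟩
  (indicator (R (z , b)) + indicator (R (b , z))) + (#[ R ∘ (z ,_) ] bs + #[ R ∘ (_, z) ] bs)
    ≡⟨ cong₂ _+_ (indicator-representation-swap n z≢b) (#-representation-swap n bs z≢bs) ⟩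
  indicator (z ℤ.+ b ℤ.≟ n) + #[ (λ b → z ℤ.+ b ℤ.≟ n) ] bs
    ≡⟨ #-∷ (λ b → z ℤ.+ b ℤ.≟ n) b bs ⟨
  #[ (λ b → z ℤ.+ b ℤ.≟ n) ] (b ∷ bs) ∎
  where
  open ≡-Reasoning
  R : Decidable (Representation n)
  R = representation? n

r-∷ : ∀ n {z} {A : List ℤ} → All (z ≢_) A →
  r (z ∷ A) n ≡ indicator (z ℤ.+ z ℤ.≟ n) + #[ (λ a → z ℤ.+ a ℤ.≟ n) ] A + r A n
r-∷ n {z} {A} z≢A = begin
  r (z ∷ A) n
    ≡⟨ #-++ R (map (z ,_) (z ∷ A)) (cartesianProduct A (z ∷ A)) ⟩
  #[ R ] ((z , z) ∷ map (z ,_) A) + #[ R ] (cartesianProduct A (z ∷ A))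
    ≡⟨ cong₂ _+_ (trans (#-∷ R (z , z) _) (cong (diag +_) (#-map R (z ,_) A)))
                 (#-cartesianProduct-∷ʳ R A z A) ⟩
  (diag + row) + (column + r A n)
    ≡⟨ ℕₚ.+-assoc (diag + row) column (r A n) ⟨
  ((diag + row) + column) + r A n
    ≡⟨ cong (_+ r A n) (ℕₚ.+-assoc diag row column) ⟩
  (diag + (row + column)) + r A n
    ≡⟨ cong₂ (λ d s → d + s + r A n)
             (indicator-representation-diag n z) (#-representation-swap n A z≢A) ⟩
  indicator (z ℤ.+ z ℤ.≟ n) + #[ (λ a → z ℤ.+ a ℤ.≟ n) ] A + r A n ∎
  where
  open ≡-Reasoning
  R : Decidable (Representation n)
  R = representation? n
  diag row column : ℕ
  diag = indicator (R (z , z))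
  row = #[ R ∘ (z ,_) ] A
  column = #[ R ∘ (_, z) ] A

r-none : ∀ n (A : List ℤ) → (∀ {a b} → a ∈ A → b ∈ A → a ℤ.+ b ≢ n) → r A n ≡ 0
r-none n A no-sum = #-none (representation? n) (All.tabulate λ {(a , b)} ab∈ (_ , a+b≡n) →
  let (a∈ , b∈) = ∈-cartesianProduct⁻ A A ab∈ in no-sum a∈ b∈ a+b≡n)

count-suc-≢ : ∀ u m {n} → u (suc m) ≢ n → count u (suc m) n ≡ count u m n
count-suc-≢ u m {n} new≢n with u (suc m) ℤ.≟ n
... | yes new≡n = ⊥-elim (new≢n new≡n)
... | no  _     = ℕₚ.+-identityʳ _

count-suc-new : ∀ u m → count u (suc m) (u (suc m)) ≡ suc (count u m (u (suc m)))
count-suc-new u m with u (suc m) ℤ.≟ u (suc m)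
... | yes _   = ℕₚ.+-comm _ 1
... | no  u≢u = ⊥-elim (u≢u refl)

count-suc-≤ : ∀ u m (ρ : ℤ → ℕ) → (∀ n → count u m n ≤ ρ n) →
  count u (suc m) (u (suc m)) ≤ ρ (u (suc m)) → ∀ n → count u (suc m) n ≤ ρ n
count-suc-≤ u m ρ below at-new n with n ℤ.≟ u (suc m)
... | yes refl = at-new
... | no  n≢new = subst (_≤ ρ n) (sym (count-suc-≢ u m (n≢new ∘ sym))) (below n)

≤-≤∞-trans : ∀ {v w} c → v ≤ w → w ≤∞ c → v ≤∞ c
≤-≤∞-trans (fin c) v≤w w≤c = ℕₚ.≤-trans v≤w w≤c
≤-≤∞-trans ∞       _   _   = tt

≤1⇒≤∞ : ∀ {v} c → c ≢ fin 0 → v ≤ 1 → v ≤∞ c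
≤1⇒≤∞ (fin zero)    c≢0 _   = ⊥-elim (c≢0 refl)
≤1⇒≤∞ (fin (suc c)) _   v≤1 = ℕₚ.≤-trans v≤1 (s≤s z≤n)
≤1⇒≤∞ ∞             _   _   = tt

count≤card : ∀ {u n c} → CardIndices u n c → ∀ m → count u m n ≤∞ c
count≤card {c = fin c} (count≤c , _) m = count≤c m
count≤card {c = ∞}     _             m = tt

∣∣≤sum : ∀ {z} {zs : List ℤ} → z ∈ zs → ∣ z ∣ ≤ sum (map ∣_∣ zs)
∣∣≤sum (here refl) = ℕₚ.m≤m+n _ _
∣∣≤sum (there z∈)  = ℕₚ.≤-trans (∣∣≤sum z∈) (ℕₚ.m≤n+m _ _)

module Scaled (k : ℕ) where

  κ : ℤ
  κ = +[1+ k ]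

  infix 4 _∈[_,_]
  record _∈[_,_] (z c d : ℤ) : Set where
    constructor bounds
    field
      lower : c ℤ.* κ ℤ.≤ z
      upper : z ℤ.≤ d ℤ.* κ

  _∈[_,_]? : ∀ z c d → Dec (z ∈[ c , d ])
  z ∈[ c , d ]? = map′ (λ (l , u) → bounds l u) (λ (bounds l u) → l , u)
                       ((c ℤ.* κ ℤ.≤? z) ×-dec (z ℤ.≤? d ℤ.* κ))

  scaled-∈ : ∀ c → c ℤ.* κ ∈[ c , c ]
  scaled-∈ c = bounds ℤₚ.≤-refl ℤₚ.≤-refl

  ∣∣≤⇒∈[-1,1] : ∀ {z} → ∣ z ∣ ≤ k → z ∈[ -1 , ℤ.1ℤ ]
  ∣∣≤⇒∈[-1,1] {ℤ.+ n} n≤k = bounds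
    (subst (ℤ._≤ ℤ.+ n) (sym (ℤₚ.-1*i≡-i κ)) -≤+)
    (subst (ℤ.+ n ℤ.≤_) (sym (ℤₚ.*-identityˡ κ)) (+≤+ (ℕₚ.m≤n⇒m≤1+n n≤k)))
  ∣∣≤⇒∈[-1,1] {ℤ.-[1+ n ]} n<k = bounds
    (subst (ℤ._≤ ℤ.-[1+ n ]) (sym (ℤₚ.-1*i≡-i κ)) (-≤- (ℕₚ.<⇒≤ n<k)))
    (subst (ℤ.-[1+ n ] ℤ.≤_) (sym (ℤₚ.*-identityˡ κ)) -≤+)

  ∈-+ : ∀ {z z' c d c' d'} → z ∈[ c , d ] → z' ∈[ c' , d' ] → z ℤ.+ z' ∈[ c ℤ.+ c' , d ℤ.+ d' ]
  ∈-+ {c = c} {d} {c'} {d'} (bounds l u) (bounds l' u') = bounds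
    (subst (ℤ._≤ _) (sym (ℤₚ.*-distribʳ-+ κ c c')) (ℤₚ.+-mono-≤ l l'))
    (subst (_ ℤ.≤_) (sym (ℤₚ.*-distribʳ-+ κ d d')) (ℤₚ.+-mono-≤ u u'))

  ∈-neg : ∀ {z c d} → z ∈[ c , d ] → ℤ.- z ∈[ ℤ.- d , ℤ.- c ]
  ∈-neg {c = c} {d} (bounds l u) = bounds
    (subst (ℤ._≤ _) (ℤₚ.neg-distribˡ-* d κ) (ℤₚ.neg-mono-≤ u))
    (subst (_ ℤ.≤_) (ℤₚ.neg-distribˡ-* c κ) (ℤₚ.neg-mono-≤ l))

  ∈-widen : ∀ {z c d c' d'} → c' ℤ.≤ c → d ℤ.≤ d' → z ∈[ c , d ] → z ∈[ c' , d' ]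
  ∈-widen c'≤c d≤d' (bounds l u) = bounds
    (ℤₚ.≤-trans (ℤₚ.*-monoʳ-≤-nonNeg κ c'≤c) l)
    (ℤₚ.≤-trans u (ℤₚ.*-monoʳ-≤-nonNeg κ d≤d'))

  -- Comparisons between the scale constants are closed, so they are discharged by
  -- evaluation through the implicit True arguments here and below.
  ∈-< : ∀ {z z' c d c' d'} → z ∈[ c , d ] → z' ∈[ c' , d' ] → {_ : True (d ℤ.<? c')} → z ℤ.< z'
  ∈-< (bounds _ u) (bounds l' _) {d<c'} =
    ℤₚ.≤-<-trans u (ℤₚ.<-≤-trans (ℤₚ.*-monoʳ-<-pos κ (toWitness d<c')) l')

  ∈-apart : ∀ {z c d c' d'} → z ∈[ c , d ] → z ∈[ c' , d' ] →
            {_ : True ((d ℤ.<? c') ⊎-dec (d' ℤ.<? c))} → ⊥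
  ∈-apart z∈ z∈' {apart} with toWitness apart
  ... | inj₁ d<c' = ℤₚ.<-irrefl refl (∈-< z∈ z∈' {fromWitness d<c'})
  ... | inj₂ d'<c = ℤₚ.<-irrefl refl (∈-< z∈' z∈ {fromWitness d'<c})

  Supported : ℤ → ℤ → ℕ → ℤ → Set
  Supported c d v n = v ≤ 1 × (1 ≤ v → n ∈[ c , d ])

  supported-outside : ∀ {c d v n} → Supported c d v n → ¬ n ∈[ c , d ] → v ≡ 0
  supported-outside {v = zero}  _              _  = refl
  supported-outside {v = suc _} (_ , in-range) n∉ = ⊥-elim (n∉ (in-range (s≤s z≤n)))

  supported-+ : ∀ {c d c' d' v v' n} → Supported c d v n → Supported c' d' v' n →
    {_ : True (d ℤ.<? c')} {_ : True (c ℤ.≤? c')} {_ : True (d ℤ.≤? d')} →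
    Supported c d' (v + v') n
  supported-+ {v = zero} _ (v'≤1 , in-range') {_} {c≤c'} =
    v'≤1 , ∈-widen (toWitness c≤c') ℤₚ.≤-refl ∘ in-range'
  supported-+ {v = suc zero} {v' = zero} (_ , in-range) _ {_} {_} {d≤d'} =
    s≤s z≤n , λ _ → ∈-widen ℤₚ.≤-refl (toWitness d≤d') (in-range (s≤s z≤n))
  supported-+ {v = suc zero} {v' = suc _} (_ , in-range) (_ , in-range') {d<c'} =
    ⊥-elim (ℤₚ.<-irrefl refl (∈-< (in-range (s≤s z≤n)) (in-range' (s≤s z≤n)) {d<c'}))
  supported-+ {v = suc (suc _)} (s≤s () , _) _

  indicator-supported : ∀ {z c d} n → z ∈[ c , d ] → Supported c d (indicator (z ℤ.≟ n)) n
  indicator-supported {z} n z∈ =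
    indicator≤1 (z ℤ.≟ n) , λ pos → subst (_∈[ _ , _ ]) (indicator-witness (z ℤ.≟ n) pos) z∈

  #-supported : ∀ {z c d} n {as : List ℤ} → Unique as → All (λ a → z ℤ.+ a ∈[ c , d ]) as →
                Supported c d (#[ (λ a → z ℤ.+ a ℤ.≟ n) ] as) n
  #-supported {z} n {as} as-unique sums∈ =
    #-unique≤1 _ (λ z+a≡n z+b≡n → ∙-cancelˡ z _ _ (trans z+a≡n (sym z+b≡n))) as-unique ,
    λ pos → let (z+a∈ , z+a≡n) = All.lookupAny sums∈ (#-any _ as pos)
            in  subst (_∈[ _ , _ ]) z+a≡n z+a∈

module Extension (A L : List ℤ) (t : ℤ) (A-unique : Unique A) where
  open Scaled (sum (map ∣_∣ (t ∷ A ++ L)))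

  x y : ℤ
  x = ℤ.+ 5 ℤ.* κ
  y = t ℤ.- x

  B : List ℤ
  B = y ∷ x ∷ A

  Small : ℤ → Set
  Small n = n ∈[ -2 , ℤ.+ 2 ]

  bounded : ∀ {z} → z ∈ t ∷ A ++ L → z ∈[ -1 , ℤ.1ℤ ]
  bounded = ∣∣≤⇒∈[-1,1] ∘ ∣∣≤sum

  t∈ : t ∈[ -1 , ℤ.1ℤ ]
  t∈ = bounded (here refl)

  A∈ : ∀ {a} → a ∈ A → a ∈[ -1 , ℤ.1ℤ ]
  A∈ = bounded ∘ there ∘ ∈-++⁺ˡ

  L∈ : ∀ {l} → l ∈ L → l ∈[ -1 , ℤ.1ℤ ]
  L∈ = bounded ∘ there ∘ ∈-++⁺ʳ A

  small : ∀ {z} → z ∈[ -1 , ℤ.1ℤ ] → Small z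
  small = ∈-widen (from-yes (-2 ℤ.≤? -1)) (from-yes (ℤ.1ℤ ℤ.≤? ℤ.+ 2))

  x∈ : x ∈[ ℤ.+ 5 , ℤ.+ 5 ]
  x∈ = scaled-∈ (ℤ.+ 5)

  y∈ : y ∈[ -6 , -4 ]
  y∈ = ∈-+ t∈ (∈-neg x∈)

  y+x≡t : y ℤ.+ x ≡ t
  y+x≡t = //-rightDividesˡ x t

  x≢A : All (x ≢_) A
  x≢A = All.tabulate λ a∈ x≡a → ℤₚ.<⇒≢ (∈-< (A∈ a∈) x∈) (sym x≡a)

  y≢xA : All (y ≢_) (x ∷ A)
  y≢xA = ℤₚ.<⇒≢ (∈-< y∈ x∈) ∷ All.tabulate λ a∈ → ℤₚ.<⇒≢ (∈-< y∈ (A∈ a∈))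

  B-unique : Unique B
  B-unique = y≢xA ∷ x≢A ∷ A-unique

  0∉B : 0ℤ ∉ A → 0ℤ ∉ B
  0∉B 0∉A (here 0≡y)         = ∈-apart (scaled-∈ 0ℤ) (subst (_∈[ -6 , -4 ]) (sym 0≡y) y∈)
  0∉B 0∉A (there (here 0≡x)) = ∈-apart (scaled-∈ 0ℤ) (subst (_∈[ ℤ.+ 5 , ℤ.+ 5 ]) (sym 0≡x) x∈)
  0∉B 0∉A (there (there 0∈A)) = 0∉A 0∈A

  farSums : ℤ → ℕ
  farSums n = indicator (y ℤ.+ y ℤ.≟ n) + #[ (λ a → y ℤ.+ a ℤ.≟ n) ] A
            + #[ (λ a → x ℤ.+ a ℤ.≟ n) ] A + indicator (x ℤ.+ x ℤ.≟ n)

  supported-yy : ∀ n → Supported -12 -8 (indicator (y ℤ.+ y ℤ.≟ n)) n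
  supported-yy n = indicator-supported n (∈-+ y∈ y∈)

  supported-yA : ∀ n → Supported -7 -3 (#[ (λ a → y ℤ.+ a ℤ.≟ n) ] A) n
  supported-yA n = #-supported {y} n A-unique (All.tabulate λ a∈ → ∈-+ y∈ (A∈ a∈))

  supported-xA : ∀ n → Supported (ℤ.+ 4) (ℤ.+ 6) (#[ (λ a → x ℤ.+ a ℤ.≟ n) ] A) n
  supported-xA n = #-supported {x} n A-unique (All.tabulate λ a∈ → ∈-+ x∈ (A∈ a∈))

  supported-xx : ∀ n → Supported (ℤ.+ 10) (ℤ.+ 10) (indicator (x ℤ.+ x ℤ.≟ n)) n
  supported-xx n = indicator-supported n (∈-+ x∈ x∈)

  farSums≤1 : ∀ n → farSums n ≤ 1
  farSums≤1 n = proj₁ (supported-+ (supported-+ (supported-+ (supported-yy n) (supported-yA n))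
                                                (supported-xA n))
                                   (supported-xx n))

  farSums-small : ∀ {n} → Small n → farSums n ≡ 0
  farSums-small {n} n-small =
    cong₂ _+_ (cong₂ _+_ (cong₂ _+_ (vanish (supported-yy n)) (vanish (supported-yA n)))
                         (vanish (supported-xA n)))
              (vanish (supported-xx n))
    where
    vanish : ∀ {c d v} → Supported c d v n → {_ : True ((d ℤ.<? -2) ⊎-dec (ℤ.+ 2 ℤ.<? c))} → v ≡ 0
    vanish supported {apart} = supported-outside supported λ n∈ → ∈-apart n∈ n-small {apart}

  r-B : ∀ n → r B n ≡ indicator (y ℤ.+ x ℤ.≟ n) + farSums n + r A n
  r-B n = begin
    r (y ∷ x ∷ A) n
      ≡⟨ r-∷ n y≢xA ⟩
    yy + #[ (λ b → y ℤ.+ b ℤ.≟ n) ] (x ∷ A) + r (x ∷ A) n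
      ≡⟨ cong₂ (λ s ρ → yy + s + ρ) (#-∷ (λ b → y ℤ.+ b ℤ.≟ n) x A) (r-∷ n x≢A) ⟩
    yy + (yx + yA) + (xx + xA + r A n)
      ≡⟨ rearrange yy yx yA xx xA (r A n) ⟩
    yx + farSums n + r A n ∎
    where
    open ≡-Reasoning
    yy yx xx yA xA : ℕ
    yy = indicator (y ℤ.+ y ℤ.≟ n)
    yx = indicator (y ℤ.+ x ℤ.≟ n)
    xx = indicator (x ℤ.+ x ℤ.≟ n)
    yA = #[ (λ a → y ℤ.+ a ℤ.≟ n) ] A
    xA = #[ (λ a → x ℤ.+ a ℤ.≟ n) ] A
    rearrange : ∀ a b c d e f → a + (b + c) + (d + e + f) ≡ b + (a + c + e + d) + f
    rearrange = solve-∀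

  r-A-large : ∀ {n} → ¬ Small n → r A n ≡ 0
  r-A-large n-large = r-none _ A λ a∈ b∈ a+b≡n → n-large (subst Small a+b≡n (∈-+ (A∈ a∈) (A∈ b∈)))

  r-A≤r-B : ∀ n → r A n ≤ r B n
  r-A≤r-B n = subst (r A n ≤_) (sym (r-B n)) (ℕₚ.m≤n+m (r A n) _)

  r-B-t : r B t ≡ suc (r A t)
  r-B-t = trans (r-B t) (cong₂ (λ i s → i + s + r A t) (indicator-yes (y ℤ.+ x ℤ.≟ t) y+x≡t)
                                                      (farSums-small (small t∈)))

  r-B-≢t : ∀ {n} → n ≢ t → r B n ≡ farSums n + r A n
  r-B-≢t {n} n≢t = trans (r-B n) (cong (λ i → i + farSums n + r A n)
    (indicator-no (y ℤ.+ x ℤ.≟ n) λ y+x≡n → n≢t (trans (sym y+x≡n) y+x≡t)))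

  r-B-elsewhere : ∀ {n} → n ≢ t → r B n ≡ r A n ⊎ (n ∉ L × r B n ≤ 1)
  r-B-elsewhere {n} n≢t with n ∈[ -2 , ℤ.+ 2 ]?
  ... | yes n-small = inj₁ (trans (r-B-≢t n≢t) (cong (_+ r A n) (farSums-small n-small)))
  ... | no  n-large = inj₂ ((λ n∈L → n-large (small (L∈ n∈L))) , (begin
    r B n              ≡⟨ r-B-≢t n≢t ⟩
    farSums n + r A n  ≡⟨ cong (farSums n +_) (r-A-large n-large) ⟩
    farSums n + 0      ≡⟨ ℕₚ.+-identityʳ (farSums n) ⟩
    farSums n          ≤⟨ farSums≤1 n ⟩
    1                  ∎))
    where open ℕₚ.≤-Reasoning

lemma2p2 : (f : ℤ → ℕ∞) → (∃ λ (L : List ℤ) → ∀ n → f n ≡ fin 0 → n ∈ L)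
    → (u : ℕ → ℤ) → (∀ n → CardIndices u n (f n))
    → (A : List ℤ) → Unique A → 0ℤ ∉ A → (∀ n → r A n ≤∞ f n)
    → (m : ℕ) → (∀ n → count u m n ≤ r A n)
    → Σ (List ℤ) λ B → Unique B × A ⊆ B × 0ℤ ∉ B × (∀ n → r B n ≤∞ f n)
        × (∀ n → count u (suc m) n ≤ r B n)
lemma2p2 f (L , zeros∈L) u card A A-unique 0∉A r-A≤f m count≤r-A
  with count u (suc m) (u (suc m)) ≤? r A (u (suc m))
... | yes enough = A , A-unique , id , 0∉A , r-A≤f , count-suc-≤ u m (r A) count≤r-A enough
... | no  short  = B , B-unique , there ∘ there , 0∉B 0∉A , r-B≤f ,
                   count-suc-≤ u m (r B) (λ n → ℕₚ.≤-trans (count≤r-A n) (r-A≤r-B n)) count≤r-B-t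
  where
  t : ℤ
  t = u (suc m)
  open Extension A L t A-unique

  r-B≤f : ∀ n → r B n ≤∞ f n
  r-B≤f n with n ℤ.≟ t
  ... | yes refl = ≤-≤∞-trans (f t) (subst (_≤ count u (suc m) t) (sym r-B-t) (ℕₚ.≰⇒> short))
                                    (count≤card (card t) (suc m))
  ... | no  n≢t with r-B-elsewhere n≢t
  ...   | inj₁ unchanged      = subst (_≤∞ f n) (sym unchanged) (r-A≤f n)
  ...   | inj₂ (n∉L , r-B≤1) = ≤1⇒≤∞ (f n) (n∉L ∘ zeros∈L n) r-B≤1

  count≤r-B-t : count u (suc m) t ≤ r B t
  count≤r-B-t = begin
    count u (suc m) t ≡⟨ count-suc-new u m ⟩
    suc (count u m t) ≤⟨ s≤s (count≤r-A t) ⟩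
    suc (r A t)       ≡⟨ r-B-t ⟨
    r B t             ∎
    where open ℕₚ.≤-Reasoning
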